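{- Let $\delta\in\mathbb{Z}^+$, $z_0,\dots,z_\nu\in\mathbb{N}$, and $$P(z_0,\dots,z_\nu)=\sum_{\substack{i_0,\dots,i_\nu\in\mathbb{N}\\ i_0+\dots+i_\nu\le\delta}}a_{i_0,\dots,i_\nu}z_0^{i_0}\cdots z_\nu^{i_\nu}$$ with $a_{i_0,\dots,i_\nu}\in\mathbb{Z}$ and $|a_{i_0,\dots,i_\nu}|\le L$ for some $L\in\mathbb{Z}^+$. Let $p>1$ be an integer and let $B,X\in p\uparrow$ with $$B>X>\delta!\,L\,(1+z_0+z_1+\dots+z_\nu)^\delta.$$ Let $n_i=(\delta+1)^i$ for $i=0,1,2,\dots$. Set $c=1+\sum_{i=0}^\nu z_iB^{n_i}$ and $$K=c^\delta\sum_{\substack{i_0,\dots,i_\nu\in\mathbb{N}\\ i_0+\dots+i_\nu\le\delta}} i_0!\cdots i_\nu!\,(\delta-i_0-\dots-i_\nu)!\,a_{i_0,\dots,i_\nu}\,B^{\,n_{\nu+1}-\sum_{s=0}^\nu i_sn_s}+X\sum_{i=0}^{(2\delta+1)n_\nu}B^i.$$ Then $B^{(2\delta+1)n_\nu}<K<B^{(2\delta+1)n_\nu+1}$, and $$P(z_0,\dots,z_\nu)=0\iff \tau_p\bigl(K,(X-1)B^{n_{\nu+1}}\bigr)=0.$$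
   Context: For a positive integer $q$, $q\uparrow:=\{q^n: n\in\mathbb{N}\}$. For an integer $p>1$ and $a,b\in\mathbb{N}$, $\tau_p(a,b)$ denotes the number of carries occurring in the addition of $a$ and $b$ in base $p$. -}

module Defs where

open import Data.Nat using (ℕ; zero; suc; _+_; _*_; _∸_; _^_; _≤_; _<_)
open import Data.Nat.DivMod using (_/_; _%_)
open import Data.Nat using (_!)
open import Data.Integer as ℤ using (ℤ; +_)
open import Data.Fin using (Fin; toℕ)
import Data.Fin as F
open import Data.Vec using (Vec; []; _∷_; lookup)
open import Data.List using (List; []; _∷_; map; concatMap; upTo)
open import Data.Product using (∃)
open import Relation.Binary.PropositionalEquality using (_≡_)
open import Relation.Nullary.Decidable using (does)
open import Data.Bool using (if_then_else_)
import Data.Nat as ℕ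

_∈_↑ : ℕ → ℕ → Set
B ∈ q ↑ = ∃ λ n → B ≡ q ^ n

carriesAux : (k fuel c a b : ℕ) → ℕ
carriesAux k zero c a b = 0
carriesAux k (suc fuel) c a b =
  let s = a % suc k + b % suc k + c in
  if does (suc k ℕ.≤? s)
    then suc (carriesAux k fuel 1 (a / suc k) (b / suc k))
    else carriesAux k fuel 0 (a / suc k) (b / suc k)

-- τ_p(a,b): number of carries in the base-p addition of a and b (meaningful for p > 1).
-- a + b + 1 digit positions suffice for p ≥ 2.
τ : (p a b : ℕ) → ℕ
τ zero a b = 0
τ (suc k) a b = carriesAux k (a + b + 1) 0 a b

Σℕ : ∀ {k} → (Fin k → ℕ) → ℕ
Σℕ {zero} f = 0
Σℕ {suc k} f = f F.zero + Σℕ (λ i → f (F.suc i))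

Πℕ : ∀ {k} → (Fin k → ℕ) → ℕ
Πℕ {zero} f = 1
Πℕ {suc k} f = f F.zero * Πℕ (λ i → f (F.suc i))

Σupto : ℕ → (ℕ → ℕ) → ℕ
Σupto zero f = f 0
Σupto (suc m) f = Σupto m f + f (suc m)

∣_∣ᵥ : ∀ {k} → Vec ℕ k → ℕ
∣ v ∣ᵥ = Σℕ (lookup v)

multiIdx : (k d : ℕ) → List (Vec ℕ k)
multiIdx zero d = [] ∷ []
multiIdx (suc k) d = concatMap (λ i → map (i ∷_) (multiIdx k (d ∸ i))) (upTo (suc d))

Σℤ : ∀ {A : Set} → List A → (A → ℤ) → ℤ
Σℤ [] f = + 0
Σℤ (x ∷ xs) f = f x ℤ.+ Σℤ xs f

evalP : (ν δ : ℕ) → (Vec ℕ (suc ν) → ℤ) → Vec ℕ (suc ν) → ℤ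
evalP ν δ a z = Σℤ (multiIdx (suc ν) δ) λ i → a i ℤ.* + Πℕ (λ s → lookup z s ^ lookup i s)

nIdx : ℕ → ℕ → ℕ
nIdx δ i = suc δ ^ i

cVal : (ν δ B : ℕ) → Vec ℕ (suc ν) → ℕ
cVal ν δ B z = 1 + Σℕ (λ s → lookup z s * B ^ nIdx δ (toℕ s))

KVal : (ν δ B X : ℕ) → (Vec ℕ (suc ν) → ℤ) → Vec ℕ (suc ν) → ℤ
KVal ν δ B X a z =
  + (cVal ν δ B z ^ δ) ℤ.*
    Σℤ (multiIdx (suc ν) δ) (λ i →
      + (Πℕ (λ s → lookup i s !) * (δ ∸ ∣ i ∣ᵥ) !) ℤ.* a i ℤ.*
      + (B ^ (nIdx δ (suc ν) ∸ Σℕ (λ s → lookup i s * nIdx δ (toℕ s)))))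
  ℤ.+ + (X * Σupto ((2 * δ + 1) * nIdx δ ν) (λ i → B ^ i))

module Submission where

-- Let E(i) = Σ_s i_s (δ+1)^s, N = n_{ν+1}, M = (2δ+1)n_ν, w_i = i_0!⋯i_ν!(δ-|i|)!.
-- By the multinomial theorem c^δ = Σ_j A_j B^{E(j)} with A_j = (δ choose j) z^j, so
-- c^δ·Σ_i w_i a_i B^{N-E(i)} = Σ_{k≤M} C_k B^k, where C_k collects the A_j w_i a_i
-- with E(j) + N - E(i) = k.  E is injective on {|i| ≤ δ} (base-(δ+1) digits), so
-- for fixed j, k at most one i contributes: |C_k| ≤ δ!·L·Σ_j A_j = δ!L(1+Σz)^δ < X,
-- and C_N = Σ_j A_j w_j a_j = δ!·P(z).  Hence K = Σ_{k≤M} (X + C_k) B^k is a base-B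
-- expansion with digits in [1, 2X) ⊆ [1, B), giving the bounds on K, and X divides
-- ⌊K/B^N⌋ iff X ∣ X + C_N iff P(z) = 0.  Finally, for X = p^e and Q = p^T, adding
-- (X-1)·Q to a carries nowhere iff p^e ∣ ⌊a/Q⌋ (a nonzero digit of a meets a digit p-1).
-- The file develops: finite sums over lists, the multinomial theorem, the exponent map
-- E, base-B expansions, carries, the coefficients C_k, and then the theorem.

open import Defs
open import Level using (0ℓ)
open import Algebra.Bundles using (CommutativeSemiring)
open import Data.Nat using (ℕ; zero; suc; _∸_; _^_; _≤_; _<_; z≤n; s≤s; NonZero; _!)
open import Data.Nat.Combinatorics using (_C_; nCk≡n!/k![n-k]!; k![n∸k]!∣n!)
open import Data.Nat.DivMod
open import Data.Nat.Divisibility using (_∣_; divides; divides-refl; ∣⇒≤; ∣-trans; m∣m*n)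
open import Data.Integer using (ℤ; +_; -[1+_]; ∣_∣)
open import Data.Fin using (Fin; toℕ)
import Data.Fin as F
import Data.Fin.Properties as FP
open import Data.Vec using (Vec; []; _∷_; lookup)
open import Data.List using (List; []; _∷_; _++_; map; concatMap; upTo; applyUpTo; [_])
open import Data.List.Relation.Unary.All as All using (All; []; _∷_)
open import Data.List.Relation.Unary.All.Properties using (map⁺; concat⁺; applyUpTo⁺₁)
open import Data.Product using (_×_; _,_; ∃; proj₁; proj₂)
open import Data.Sum using (_⊎_; inj₁; inj₂)
open import Data.Empty using (⊥-elim)
open import Data.Bool using (true; false; T)
open import Data.Unit using (tt)
open import Function.Properties.Equivalence using (⇔-setoid)
open import Function.Base using (_∘_)
open import Function.Bundles using (_⇔_; mk⇔; Equivalence)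
import Relation.Binary.PropositionalEquality as ≡
open ≡ using (_≡_; _≢_)
open import Relation.Nullary using (Dec; yes; no; ¬_)
import Data.Integer as ℤ
import Data.Integer.Properties as Z
import Data.Nat as ℕ
import Data.Nat.Properties as N
import Data.List.Properties as LP
import Data.Nat.Tactic.RingSolver as NS
import Data.Integer.Tactic.RingSolver as ZS

module ListSum {c ℓ} (R : CommutativeSemiring c ℓ) where
  open CommutativeSemiring R
  open import Algebra.Properties.CommutativeSemigroup +-commutativeSemigroup using (interchange)
  open import Relation.Binary.Reasoning.Setoid setoid

  sumL : {A : Set} → List A → (A → Carrier) → Carrier
  sumL []       f = 0#
  sumL (x ∷ xs) f = f x + sumL xs f

  sumL-cong : {A : Set} (xs : List A) {f g : A → Carrier} → (∀ x → f x ≈ g x) → sumL xs f ≈ sumL xs g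
  sumL-cong []       e = refl
  sumL-cong (x ∷ xs) e = +-cong (e x) (sumL-cong xs e)

  sumL-congᴬ : {A : Set} {P : A → Set} {xs : List A} {f g : A → Carrier} →
               All P xs → (∀ x → P x → f x ≈ g x) → sumL xs f ≈ sumL xs g
  sumL-congᴬ []         e = refl
  sumL-congᴬ (px ∷ pxs) e = +-cong (e _ px) (sumL-congᴬ pxs e)

  sumL-++ : {A : Set} (xs ys : List A) (f : A → Carrier) → sumL (xs ++ ys) f ≈ sumL xs f + sumL ys f
  sumL-++ []       ys f = sym (+-identityˡ _)
  sumL-++ (x ∷ xs) ys f = trans (+-congˡ (sumL-++ xs ys f)) (sym (+-assoc _ _ _))

  sumL-map : {A B : Set} (h : A → B) (xs : List A) (f : B → Carrier) → sumL (map h xs) f ≈ sumL xs (f ∘ h)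
  sumL-map h []       f = refl
  sumL-map h (x ∷ xs) f = +-congˡ (sumL-map h xs f)

  sumL-concatMap : {A B : Set} (h : A → List B) (xs : List A) (f : B → Carrier) →
                   sumL (concatMap h xs) f ≈ sumL xs (λ x → sumL (h x) f)
  sumL-concatMap h []       f = refl
  sumL-concatMap h (x ∷ xs) f = trans (sumL-++ (h x) _ f) (+-congˡ (sumL-concatMap h xs f))

  sumL-0 : {A : Set} (xs : List A) → sumL xs (λ _ → 0#) ≈ 0#
  sumL-0 []       = refl
  sumL-0 (x ∷ xs) = trans (+-identityˡ _) (sumL-0 xs)

  sumL-+ : {A : Set} (xs : List A) (f g : A → Carrier) → sumL xs (λ x → f x + g x) ≈ sumL xs f + sumL xs g
  sumL-+ []       f g = sym (+-identityˡ 0#)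
  sumL-+ (x ∷ xs) f g = trans (+-congˡ (sumL-+ xs f g)) (interchange _ _ _ _)

  sumL-*ˡ : {A : Set} (c : Carrier) (xs : List A) (f : A → Carrier) → c * sumL xs f ≈ sumL xs (λ x → c * f x)
  sumL-*ˡ c []       f = zeroʳ c
  sumL-*ˡ c (x ∷ xs) f = trans (distribˡ c _ _) (+-congˡ (sumL-*ˡ c xs f))

  sumL-*ʳ : {A : Set} (c : Carrier) (xs : List A) (f : A → Carrier) → sumL xs f * c ≈ sumL xs (λ x → f x * c)
  sumL-*ʳ c []       f = zeroˡ c
  sumL-*ʳ c (x ∷ xs) f = trans (distribʳ c _ _) (+-congˡ (sumL-*ʳ c xs f))

  sumL-swap : {A B : Set} (xs : List A) (ys : List B) (f : A → B → Carrier) →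
              sumL xs (λ x → sumL ys (f x)) ≈ sumL ys (λ y → sumL xs (λ x → f x y))
  sumL-swap []       ys f = sym (sumL-0 ys)
  sumL-swap (x ∷ xs) ys f = trans (+-congˡ (sumL-swap xs ys f)) (sym (sumL-+ ys (f x) _))

  sumL-upTo-suc : (n : ℕ) (f : ℕ → Carrier) → sumL (upTo (suc n)) f ≈ sumL (upTo n) f + f n
  sumL-upTo-suc n f = begin
    sumL (upTo (suc n)) f        ≡⟨ ≡.cong (λ l → sumL l f) (LP.upTo-∷ʳ n) ⟨
    sumL (upTo n ++ [ n ]) f     ≈⟨ sumL-++ (upTo n) [ n ] f ⟩
    sumL (upTo n) f + (f n + 0#) ≈⟨ +-congˡ (+-identityʳ (f n)) ⟩
    sumL (upTo n) f + f n        ∎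

  sumL-upTo-vanish : (n r : ℕ) (f : ℕ → Carrier) → n ≤ r → (∀ k → k ≢ r → f k ≈ 0#) → sumL (upTo n) f ≈ 0#
  sumL-upTo-vanish zero    r f n≤r e = refl
  sumL-upTo-vanish (suc n) r f n<r e = begin
    sumL (upTo (suc n)) f ≈⟨ sumL-upTo-suc n f ⟩
    sumL (upTo n) f + f n ≈⟨ +-cong (sumL-upTo-vanish n r f (N.<⇒≤ n<r) e) (e n (N.<⇒≢ n<r)) ⟩
    0# + 0#               ≈⟨ +-identityˡ 0# ⟩
    0#                    ∎

  sumL-upTo-single : (n r : ℕ) (f : ℕ → Carrier) → r < n → (∀ k → k ≢ r → f k ≈ 0#) → sumL (upTo n) f ≈ f r
  sumL-upTo-single (suc n) r f r<1+n e with N.m≤n⇒m<n∨m≡n (N.≤-pred r<1+n)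
  ... | inj₁ r<n = begin
    sumL (upTo (suc n)) f ≈⟨ sumL-upTo-suc n f ⟩
    sumL (upTo n) f + f n ≈⟨ +-cong (sumL-upTo-single n r f r<n e) (e n (N.>⇒≢ r<n)) ⟩
    f r + 0#              ≈⟨ +-identityʳ (f r) ⟩
    f r                   ∎
  ... | inj₂ ≡.refl = begin
    sumL (upTo (suc n)) f ≈⟨ sumL-upTo-suc n f ⟩
    sumL (upTo n) f + f n ≈⟨ +-congʳ (sumL-upTo-vanish n n f N.≤-refl e) ⟩
    0# + f n              ≈⟨ +-identityˡ (f n) ⟩
    f n                   ∎

  when : {P : Set} → Dec P → Carrier → Carrier
  when (yes _) v = v
  when (no _)  v = 0#

  when-true : {P : Set} (D : Dec P) (v : Carrier) → P → when D v ≈ v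
  when-true (yes _) v p = refl
  when-true (no ¬p) v p = ⊥-elim (¬p p)

  when-false : {P : Set} (D : Dec P) (v : Carrier) → ¬ P → when D v ≈ 0#
  when-false (yes p) v ¬p = ⊥-elim (¬p p)
  when-false (no _)  v ¬p = refl

  when-⇔ : {P Q : Set} (D : Dec P) (D′ : Dec Q) (v : Carrier) → P ⇔ Q → when D v ≈ when D′ v
  when-⇔ (yes p) D′ v P⇔Q = sym (when-true D′ v (Equivalence.to P⇔Q p))
  when-⇔ (no ¬p) D′ v P⇔Q = sym (when-false D′ v (¬p ∘ Equivalence.from P⇔Q))

  when-× : {P Q S : Set} (D : Dec P) (D₁ : Dec Q) (D₂ : Dec S) (v : Carrier) → P ⇔ (Q × S) →
           when D v ≈ when D₁ (when D₂ v)
  when-× D (yes q) (yes s) v P⇔Q×S = when-true D v (Equivalence.from P⇔Q×S (q , s))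
  when-× D (yes q) (no ¬s) v P⇔Q×S = when-false D v (¬s ∘ proj₂ ∘ Equivalence.to P⇔Q×S)
  when-× D (no ¬q) D₂      v P⇔Q×S = when-false D v (¬q ∘ proj₁ ∘ Equivalence.to P⇔Q×S)

  sumL-when : {A : Set} {P : Set} (D : Dec P) (xs : List A) (f : A → Carrier) →
              sumL xs (λ x → when D (f x)) ≈ when D (sumL xs f)
  sumL-when (yes _) xs f = refl
  sumL-when (no _)  xs f = sumL-0 xs

  when-implied : {P Q : Set} (D : Dec P) (D′ : Dec Q) (v : Carrier) → (P → Q) → when D v ≈ when D′ (when D v)
  when-implied D (yes q) v P→Q = refl
  when-implied D (no ¬q) v P→Q = when-false D v (¬q ∘ P→Q)

  sumL-collect : {A : Set} (xs : List A) (x : A → ℕ) (v : A → Carrier) (w : ℕ → Carrier) (M : ℕ) →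
    All (λ i → x i ≤ M) xs →
    sumL xs (λ i → v i * w (x i)) ≈ sumL (upTo (suc M)) (λ k → sumL xs (λ i → when (x i N.≟ k) (v i)) * w k)
  sumL-collect xs x v w M bounded = begin
      sumL xs (λ i → v i * w (x i))
        ≈⟨ sumL-congᴬ bounded (λ i x≤M → sym (single i x≤M)) ⟩
      sumL xs (λ i → sumL U (λ k → when (x i N.≟ k) (v i) * w k))
        ≈⟨ sumL-swap xs U _ ⟩
      sumL U (λ k → sumL xs (λ i → when (x i N.≟ k) (v i) * w k))
        ≈⟨ sumL-cong U (λ k → sym (sumL-*ʳ (w k) xs _)) ⟩
      sumL U (λ k → sumL xs (λ i → when (x i N.≟ k) (v i)) * w k) ∎
    where
      U = upTo (suc M)
      single : ∀ i → x i ≤ M → sumL U (λ k → when (x i N.≟ k) (v i) * w k) ≈ v i * w (x i)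
      single i x≤M = begin
        sumL U (λ k → when (x i N.≟ k) (v i) * w k)
          ≈⟨ sumL-upTo-single (suc M) (x i) _ (s≤s x≤M)
               (λ k k≢x → trans (*-congʳ (when-false (x i N.≟ k) (v i) (k≢x ∘ ≡.sym))) (zeroˡ (w k))) ⟩
        when (x i N.≟ x i) (v i) * w (x i)
          ≈⟨ *-congʳ (when-true (x i N.≟ x i) (v i) ≡.refl) ⟩
        v i * w (x i) ∎

-- opened only here: inside ListSum these names denote the semiring's operations
open ≡ using (refl; sym; trans; cong; cong₂; subst; subst₂; module ≡-Reasoning)
open Data.Nat using (_+_; _*_)

open module ℕΣ = ListSum N.+-*-commutativeSemiring using () renaming (sumL to Σⁿ)
open ListSum Z.+-*-commutativeSemiring

Σℤ≡sumL : {A : Set} (xs : List A) (f : A → ℤ) → Σℤ xs f ≡ sumL xs f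
Σℤ≡sumL []       f = refl
Σℤ≡sumL (x ∷ xs) f = cong (λ v → f x ℤ.+ v) (Σℤ≡sumL xs f)

sumL-+ₙ : {A : Set} (xs : List A) (f : A → ℕ) → sumL xs (λ x → + f x) ≡ + Σⁿ xs f
sumL-+ₙ []       f = refl
sumL-+ₙ (x ∷ xs) f = cong (λ v → + f x ℤ.+ v) (sumL-+ₙ xs f)

∣when∣≤ : {P : Set} (D : Dec P) (v : ℤ) → ∣ when D v ∣ ≤ ∣ v ∣
∣when∣≤ (yes _) v = N.≤-refl
∣when∣≤ (no _)  v = z≤n

sumL-abs : {A : Set} (xs : List A) (f : A → ℤ) → ∣ sumL xs f ∣ ≤ Σⁿ xs (λ x → ∣ f x ∣)
sumL-abs []       f = z≤n
sumL-abs (x ∷ xs) f = N.≤-trans (Z.∣i+j∣≤∣i∣+∣j∣ (f x) _) (N.+-monoʳ-≤ ∣ f x ∣ (sumL-abs xs f))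

Σⁿ-monoᴬ : {A : Set} {P : A → Set} {xs : List A} {f g : A → ℕ} →
           All P xs → (∀ x → P x → f x ≤ g x) → Σⁿ xs f ≤ Σⁿ xs g
Σⁿ-monoᴬ []         e = z≤n
Σⁿ-monoᴬ (px ∷ pxs) e = N.+-mono-≤ (e _ px) (Σⁿ-monoᴬ pxs e)

-- The binomial theorem in list-sum form, obtained from the standard library's
-- version for commutative semirings (stated with Fin-indexed sums and the
-- semiring's iterated multiplication and exponentiation, identified here with
-- those of ℕ).
module _ where
  import Algebra.Properties.CommutativeSemiring.Binomial N.+-*-commutativeSemiring as Binomial
  open import Algebra.Properties.Semiring.Sum N.+-*-semiring using (sum)
  open import Algebra.Properties.Semiring.Mult N.+-*-semiring using () renaming (_×_ to _×ₛ_)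
  open import Algebra.Properties.Semiring.Exp N.+-*-semiring using () renaming (_^_ to _^ₛ_)

  private
    ×ₛ≡* : ∀ m x → m ×ₛ x ≡ m * x
    ×ₛ≡* zero    x = refl
    ×ₛ≡* (suc m) x = cong (λ v → x + v) (×ₛ≡* m x)

    ^ₛ≡^ : ∀ x m → x ^ₛ m ≡ x ^ m
    ^ₛ≡^ x zero    = refl
    ^ₛ≡^ x (suc m) = cong (x *_) (^ₛ≡^ x m)

    sum≡Σⁿ : ∀ n (h f : ℕ → ℕ) → sum {n} (λ k → f (h (toℕ k))) ≡ Σⁿ (applyUpTo h n) f
    sum≡Σⁿ zero    h f = refl
    sum≡Σⁿ (suc n) h f = cong (λ v → f (h 0) + v) (sum≡Σⁿ n (h ∘ suc) f)

  binomial-theorem : ∀ x y d → (x + y) ^ d ≡ Σⁿ (upTo (suc d)) (λ k → (d C k) * x ^ k * y ^ (d ∸ k))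
  binomial-theorem x y d = begin
    (x + y) ^ d                                                   ≡⟨ ^ₛ≡^ (x + y) d ⟨
    (x + y) ^ₛ d                                                  ≡⟨ Binomial.theorem d x y ⟩
    Binomial.binomialExpansion x y d                              ≡⟨ sum≡Σⁿ (suc d) (λ k → k) _ ⟩
    Σⁿ (upTo (suc d)) (λ k → (d C k) ×ₛ (x ^ₛ k * y ^ₛ (d ∸ k)))   ≡⟨ ℕΣ.sumL-cong (upTo (suc d)) term ⟩
    Σⁿ (upTo (suc d)) (λ k → (d C k) * x ^ k * y ^ (d ∸ k))       ∎
    where
      open ≡-Reasoning
      term : ∀ k → (d C k) ×ₛ (x ^ₛ k * y ^ₛ (d ∸ k)) ≡ (d C k) * x ^ k * y ^ (d ∸ k)
      term k = begin
        (d C k) ×ₛ (x ^ₛ k * y ^ₛ (d ∸ k)) ≡⟨ ×ₛ≡* (d C k) _ ⟩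
        (d C k) * (x ^ₛ k * y ^ₛ (d ∸ k)) ≡⟨ cong₂ (λ u v → (d C k) * (u * v)) (^ₛ≡^ x k) (^ₛ≡^ y (d ∸ k)) ⟩
        (d C k) * (x ^ k * y ^ (d ∸ k))   ≡⟨ N.*-assoc (d C k) _ _ ⟨
        (d C k) * x ^ k * y ^ (d ∸ k)     ∎

-- The multinomial coefficient (d choose j₀, …, j_{k-1}, d-|j|), built as a product
-- of binomial coefficients, and the monomial y^j = Π_s y_s^{j_s}.
multinomial : ∀ {k} → ℕ → Vec ℕ k → ℕ
multinomial d []      = 1
multinomial d (x ∷ j) = (d C x) * multinomial (d ∸ x) j

monomial : ∀ {k} → (Fin k → ℕ) → Vec ℕ k → ℕ
monomial y j = Πℕ (λ s → y s ^ lookup j s)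

-- (1 + y₀ + ⋯ + y_{k-1})^d = Σ_{|j| ≤ d} (multinomial d j) y^j, by induction on k
-- using the binomial theorem for y₀ + (1 + y₁ + ⋯).
multinomial-theorem : ∀ k d (y : Fin k → ℕ) →
  (1 + Σℕ y) ^ d ≡ Σⁿ (multiIdx k d) (λ j → multinomial d j * monomial y j)
multinomial-theorem zero    d y = N.^-zeroˡ d
multinomial-theorem (suc k) d y = begin
    (1 + (y₀ + R)) ^ d
      ≡⟨ cong (_^ d) (N.+-suc y₀ R) ⟨
    (y₀ + (1 + R)) ^ d
      ≡⟨ binomial-theorem y₀ (1 + R) d ⟩
    Σⁿ (upTo (suc d)) (λ x → (d C x) * y₀ ^ x * (1 + R) ^ (d ∸ x))
      ≡⟨ ℕΣ.sumL-cong (upTo (suc d)) first-index ⟩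
    Σⁿ (upTo (suc d)) (λ x → Σⁿ (map (x ∷_) (multiIdx k (d ∸ x))) term)
      ≡⟨ ℕΣ.sumL-concatMap (λ x → map (x ∷_) (multiIdx k (d ∸ x))) (upTo (suc d)) term ⟨
    Σⁿ (multiIdx (suc k) d) term ∎
  where
    open ≡-Reasoning
    y₀ = y F.zero
    y′ = y ∘ F.suc
    R = Σℕ y′
    term = λ j → multinomial d j * monomial y j
    first-index : ∀ x → (d C x) * y₀ ^ x * (1 + R) ^ (d ∸ x) ≡ Σⁿ (map (x ∷_) (multiIdx k (d ∸ x))) term
    first-index x = begin
      (d C x) * y₀ ^ x * (1 + R) ^ (d ∸ x)
        ≡⟨ cong ((d C x) * y₀ ^ x *_) (multinomial-theorem k (d ∸ x) y′) ⟩
      (d C x) * y₀ ^ x * Σⁿ (multiIdx k (d ∸ x)) (λ j → multinomial (d ∸ x) j * monomial y′ j)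
        ≡⟨ ℕΣ.sumL-*ˡ ((d C x) * y₀ ^ x) (multiIdx k (d ∸ x)) _ ⟩
      Σⁿ (multiIdx k (d ∸ x)) (λ j → (d C x) * y₀ ^ x * (multinomial (d ∸ x) j * monomial y′ j))
        ≡⟨ ℕΣ.sumL-cong (multiIdx k (d ∸ x)) (λ j → regroup (d C x) (y₀ ^ x) (multinomial (d ∸ x) j) (monomial y′ j)) ⟩
      Σⁿ (multiIdx k (d ∸ x)) (term ∘ (x ∷_))
        ≡⟨ ℕΣ.sumL-map (x ∷_) (multiIdx k (d ∸ x)) term ⟨
      Σⁿ (map (x ∷_) (multiIdx k (d ∸ x))) term ∎
      where
        regroup : ∀ c p m q → c * p * (m * q) ≡ c * m * (p * q)
        regroup = NS.solve-∀

head≤ : ∀ {k d} x (i : Vec ℕ k) → ∣ x ∷ i ∣ᵥ ≤ d → x ≤ d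
head≤ x i = N.m+n≤o⇒m≤o x

tail≤ : ∀ {k d} x (i : Vec ℕ k) → ∣ x ∷ i ∣ᵥ ≤ d → ∣ i ∣ᵥ ≤ d ∸ x
tail≤ {d = d} x i |x∷i|≤d = N.m+n≤o⇒m≤o∸n ∣ i ∣ᵥ (subst (_≤ d) (N.+-comm x ∣ i ∣ᵥ) |x∷i|≤d)

cons≤ : ∀ {k d} x (i : Vec ℕ k) → x ≤ d → ∣ i ∣ᵥ ≤ d ∸ x → ∣ x ∷ i ∣ᵥ ≤ d
cons≤ {d = d} x i x≤d |i|≤d∸x = subst (x + ∣ i ∣ᵥ ≤_) (N.m+[n∸m]≡n x≤d) (N.+-monoʳ-≤ x |i|≤d∸x)

multiIdx-bounded : ∀ k d → All (λ j → ∣ j ∣ᵥ ≤ d) (multiIdx k d)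
multiIdx-bounded zero    d = z≤n ∷ []
multiIdx-bounded (suc k) d =
  concat⁺ (map⁺ (applyUpTo⁺₁ (λ x → x) (suc d) λ {x} x<1+d →
    map⁺ (All.map (λ {j} → cons≤ x j (N.≤-pred x<1+d)) (multiIdx-bounded k (d ∸ x)))))

weight : ∀ {k} → ℕ → Vec ℕ k → ℕ
weight d j = Πℕ (λ s → lookup j s !) * (d ∸ ∣ j ∣ᵥ) !

choose-factorials : ∀ d x → x ≤ d → (d C x) * (x ! * (d ∸ x) !) ≡ d !
choose-factorials d x x≤d = trans (cong (_* (x ! * (d ∸ x) !)) (nCk≡n!/k![n-k]! x≤d))
                                  (m/n*n≡m {{N._!*_!≢0 x (d ∸ x)}} (k![n∸k]!∣n! x≤d))

multinomial-weight : ∀ {k} d (j : Vec ℕ k) → ∣ j ∣ᵥ ≤ d → multinomial d j * weight d j ≡ d !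
multinomial-weight d []      _ = trans (N.*-identityˡ _) (N.*-identityˡ _)
multinomial-weight d (x ∷ j) |x∷j|≤d = begin
    (d C x) * multinomial (d ∸ x) j * ((x ! * P) * (d ∸ (x + ∣ j ∣ᵥ)) !)
      ≡⟨ cong (λ v → (d C x) * multinomial (d ∸ x) j * ((x ! * P) * v !)) (N.∸-+-assoc d x ∣ j ∣ᵥ) ⟨
    (d C x) * multinomial (d ∸ x) j * ((x ! * P) * (d ∸ x ∸ ∣ j ∣ᵥ) !)
      ≡⟨ regroup (d C x) (multinomial (d ∸ x) j) (x !) P ((d ∸ x ∸ ∣ j ∣ᵥ) !) ⟩
    (d C x) * x ! * (multinomial (d ∸ x) j * weight (d ∸ x) j)
      ≡⟨ cong ((d C x) * x ! *_) (multinomial-weight (d ∸ x) j |j|≤d∸x) ⟩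
    (d C x) * x ! * (d ∸ x) !
      ≡⟨ N.*-assoc (d C x) (x !) _ ⟩
    (d C x) * (x ! * (d ∸ x) !)
      ≡⟨ choose-factorials d x (head≤ x j |x∷j|≤d) ⟩
    d ! ∎
  where
    open ≡-Reasoning
    P = Πℕ (λ s → lookup j s !)
    |j|≤d∸x : ∣ j ∣ᵥ ≤ d ∸ x
    |j|≤d∸x = tail≤ x j |x∷j|≤d
    regroup : ∀ c m f p r → c * m * ((f * p) * r) ≡ c * f * (m * (p * r))
    regroup = NS.solve-∀

weight≤factorial : ∀ {k} d (j : Vec ℕ k) → ∣ j ∣ᵥ ≤ d → weight d j ≤ d !
weight≤factorial d j |j|≤d with multinomial d j | multinomial-weight d j |j|≤d
... | zero  | m·w≡d! = ⊥-elim (N.<⇒≢ (N.1≤n! d) m·w≡d!)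
... | suc m | m·w≡d! = subst (weight d j ≤_) m·w≡d! (N.m≤m+n (weight d j) (m * weight d j))

Σℕ-cong : ∀ {k} {f g : Fin k → ℕ} → (∀ s → f s ≡ g s) → Σℕ f ≡ Σℕ g
Σℕ-cong {zero}  e = refl
Σℕ-cong {suc k} e = cong₂ _+_ (e F.zero) (Σℕ-cong (e ∘ F.suc))

Σℕ-*ʳ : ∀ {k} (f : Fin k → ℕ) c → Σℕ (λ s → f s * c) ≡ Σℕ f * c
Σℕ-*ʳ {zero}  f c = refl
Σℕ-*ʳ {suc k} f c = trans (cong (λ v → f F.zero * c + v) (Σℕ-*ʳ (f ∘ F.suc) c)) (sym (N.*-distribʳ-+ c (f F.zero) _))

Σℕ-mono : ∀ {k} {f g : Fin k → ℕ} → (∀ s → f s ≤ g s) → Σℕ f ≤ Σℕ g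
Σℕ-mono {zero}  h = z≤n
Σℕ-mono {suc k} h = N.+-mono-≤ (h F.zero) (Σℕ-mono (h ∘ F.suc))

module _ {n : ℕ} .{{_ : NonZero n}} where
  %-unique : ∀ r q → r < n → (r + q * n) % n ≡ r
  %-unique r q r<n = trans ([m+kn]%n≡m%n r q n) (m<n⇒m%n≡m r<n)

  /-unique : ∀ r q → r < n → (r + q * n) / n ≡ q
  /-unique r q r<n = trans (+-distrib-/-∣ʳ r (divides-refl q)) (cong₂ _+_ (m<n⇒m/n≡0 r<n) (m*n/n≡m q n))

  remainder-quotient : ∀ x y t → x < n → (x + n * y ≡ t ⇔ (x ≡ t % n × y ≡ t / n))
  remainder-quotient x y t x<n = mk⇔ to from
    where
      x+yn : x + n * y ≡ x + y * n
      x+yn = cong (λ v → x + v) (N.*-comm n y)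
      to : x + n * y ≡ t → x ≡ t % n × y ≡ t / n
      to refl = sym (trans (cong (_% n) x+yn) (%-unique x y x<n))
              , sym (trans (cong (_/ n) x+yn) (/-unique x y x<n))
      from : x ≡ t % n × y ≡ t / n → x + n * y ≡ t
      from (refl , refl) = trans (cong (λ v → t % n + v) (N.*-comm n (t / n))) (sym (m≡m%n+[m/n]*n t n))

-- For |i| ≤ δ the
-- entries of i are exactly the base-(δ+1) digits of E(i), so E is injective
-- there, and a sum over |i| ≤ d of terms restricted to E(i) = t has at most one
-- term.
module Exponents (δ : ℕ) where

  expo : ∀ {k} → Vec ℕ k → ℕ
  expo i = Σℕ (λ s → lookup i s * nIdx δ (toℕ s))

  expo-∷ : ∀ {k} x (i : Vec ℕ k) → expo (x ∷ i) ≡ x + suc δ * expo i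
  expo-∷ x i = cong₂ _+_ (N.*-identityʳ x) (begin
      Σℕ (λ s → lookup i s * (suc δ * nIdx δ (toℕ s)))
        ≡⟨ Σℕ-cong (λ s → swap (lookup i s) (suc δ) (nIdx δ (toℕ s))) ⟩
      Σℕ (λ s → lookup i s * nIdx δ (toℕ s) * suc δ)
        ≡⟨ Σℕ-*ʳ (λ s → lookup i s * nIdx δ (toℕ s)) (suc δ) ⟩
      expo i * suc δ
        ≡⟨ N.*-comm (expo i) (suc δ) ⟩
      suc δ * expo i ∎)
    where
      open ≡-Reasoning
      swap : ∀ a b c → a * (b * c) ≡ a * c * b
      swap = NS.solve-∀

  expo-∷-digits : ∀ {k} x (i : Vec ℕ k) t → x ≤ δ → (expo (x ∷ i) ≡ t ⇔ (x ≡ t % suc δ × expo i ≡ t / suc δ))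
  expo-∷-digits x i t x≤δ = subst (λ e → (e ≡ t) ⇔ (x ≡ t % suc δ × expo i ≡ t / suc δ)) (sym (expo-∷ x i)) (remainder-quotient x (expo i) t (s≤s x≤δ))

  expo-injective : ∀ {k} (i j : Vec ℕ k) → ∣ i ∣ᵥ ≤ δ → ∣ j ∣ᵥ ≤ δ → expo i ≡ expo j → i ≡ j
  expo-injective []      []      _ _ _ = refl
  expo-injective (x ∷ i) (y ∷ j) |x∷i|≤δ |y∷j|≤δ Ex∷i≡Ey∷j =
      cong₂ _∷_ (trans (proj₁ digits-x) (sym (proj₁ digits-y)))
                (expo-injective i j (N.m+n≤o⇒n≤o x |x∷i|≤δ) (N.m+n≤o⇒n≤o y |y∷j|≤δ)
                                (trans (proj₂ digits-x) (sym (proj₂ digits-y))))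
    where
      t : ℕ
      t = expo (y ∷ j)
      digits-x : x ≡ t % suc δ × expo i ≡ t / suc δ
      digits-x = Equivalence.to (expo-∷-digits x i t (head≤ x i |x∷i|≤δ)) Ex∷i≡Ey∷j
      digits-y : y ≡ t % suc δ × expo j ≡ t / suc δ
      digits-y = Equivalence.to (expo-∷-digits y j t (head≤ y j |y∷j|≤δ)) refl

  ΣE : ∀ {k} → ℕ → ℕ → (Vec ℕ k → ℤ) → ℤ
  ΣE {k} d t g = sumL (multiIdx k d) (λ i → when (expo i N.≟ t) (g i))

  ΣE-∷ : ∀ {k} d t (g : Vec ℕ (suc k) → ℤ) → d ≤ δ →
    ΣE d t g ≡ sumL (upTo (suc d)) (λ x → when (x N.≟ t % suc δ) (ΣE (d ∸ x) (t / suc δ) (g ∘ (x ∷_))))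
  ΣE-∷ {k} d t g d≤δ = begin
      ΣE d t g
        ≡⟨ sumL-concatMap (λ x → map (x ∷_) (multiIdx k (d ∸ x))) (upTo (suc d)) _ ⟩
      sumL (upTo (suc d)) (λ x → sumL (map (x ∷_) (multiIdx k (d ∸ x))) (λ i → when (expo i N.≟ t) (g i)))
        ≡⟨ sumL-congᴬ (applyUpTo⁺₁ (λ x → x) (suc d) (λ x<1+d → x<1+d)) first-entry ⟩
      sumL (upTo (suc d)) (λ x → when (x N.≟ t % suc δ) (ΣE (d ∸ x) (t / suc δ) (g ∘ (x ∷_)))) ∎
    where
      open ≡-Reasoning
      first-entry : ∀ x → x < suc d →
        sumL (map (x ∷_) (multiIdx k (d ∸ x))) (λ i → when (expo i N.≟ t) (g i))
          ≡ when (x N.≟ t % suc δ) (ΣE (d ∸ x) (t / suc δ) (g ∘ (x ∷_)))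
      first-entry x x<1+d = begin
        sumL (map (x ∷_) (multiIdx k (d ∸ x))) (λ i → when (expo i N.≟ t) (g i))
          ≡⟨ sumL-map (x ∷_) (multiIdx k (d ∸ x)) _ ⟩
        sumL (multiIdx k (d ∸ x)) (λ i → when (expo (x ∷ i) N.≟ t) (g (x ∷ i)))
          ≡⟨ sumL-cong (multiIdx k (d ∸ x)) (λ i → when-× (expo (x ∷ i) N.≟ t) (x N.≟ t % suc δ) (expo i N.≟ t / suc δ)
                 (g (x ∷ i)) (expo-∷-digits x i t (N.≤-trans (N.≤-pred x<1+d) d≤δ))) ⟩
        sumL (multiIdx k (d ∸ x)) (λ i → when (x N.≟ t % suc δ) (when (expo i N.≟ t / suc δ) (g (x ∷ i))))
          ≡⟨ sumL-when (x N.≟ t % suc δ) (multiIdx k (d ∸ x)) _ ⟩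
        when (x N.≟ t % suc δ) (ΣE (d ∸ x) (t / suc δ) (g ∘ (x ∷_))) ∎

  digits-of : ∀ {k d} x (i : Vec ℕ k) t → d ≤ δ → ∣ x ∷ i ∣ᵥ ≤ d → expo (x ∷ i) ≡ t →
              x ≡ t % suc δ × expo i ≡ t / suc δ
  digits-of x i t d≤δ |x∷i|≤d = Equivalence.to (expo-∷-digits x i t (N.≤-trans (head≤ x i |x∷i|≤d) d≤δ))

  ΣE-empty : ∀ {k} d t (g : Vec ℕ (suc k) → ℤ) → d ≤ δ → suc d ≤ t % suc δ → ΣE d t g ≡ + 0
  ΣE-empty d t g d≤δ d<r = trans (ΣE-∷ d t g d≤δ)
    (sumL-upTo-vanish (suc d) (t % suc δ) _ d<r (λ x x≢r → when-false (x N.≟ t % suc δ) _ x≢r))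

  ΣE-collapse : ∀ {k} d t (g : Vec ℕ (suc k) → ℤ) → d ≤ δ → t % suc δ < suc d →
                ΣE d t g ≡ ΣE (d ∸ t % suc δ) (t / suc δ) (g ∘ (t % suc δ ∷_))
  ΣE-collapse d t g d≤δ r<1+d = trans (ΣE-∷ d t g d≤δ)
    (trans (sumL-upTo-single (suc d) r _ r<1+d (λ x x≢r → when-false (x N.≟ r) _ x≢r))
           (when-true (r N.≟ r) _ refl))
    where
      r : ℕ
      r = t % suc δ

  data Selection {k} (d t : ℕ) (g : Vec ℕ k → ℤ) : Set where
    no-term  : ΣE d t g ≡ + 0 → (∀ (i : Vec ℕ k) → ∣ i ∣ᵥ ≤ d → expo i ≢ t) → Selection d t g
    one-term : ∀ (i : Vec ℕ k) → ∣ i ∣ᵥ ≤ d → expo i ≡ t → ΣE d t g ≡ g i → Selection d t g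

  selection : ∀ {k} d t (g : Vec ℕ k → ℤ) → d ≤ δ → Selection d t g
  selection {zero}  d zero    g _   = one-term [] z≤n refl (Z.+-identityʳ (g []))
  selection {zero}  d (suc t) g _   = no-term refl (λ { [] _ () })
  selection {suc k} d t       g d≤δ with t % suc δ N.<? suc d
  ... | no r≮1+d = no-term (ΣE-empty d t g d≤δ (N.≮⇒≥ r≮1+d)) λ where
    (x ∷ i) |x∷i|≤d Ex∷i≡t →
      r≮1+d (subst (_< suc d) (proj₁ (digits-of x i t d≤δ |x∷i|≤d Ex∷i≡t)) (s≤s (head≤ x i |x∷i|≤d)))
  ... | yes r<1+d with selection (d ∸ t % suc δ) (t / suc δ) (g ∘ (t % suc δ ∷_)) (N.≤-trans (N.m∸n≤m d (t % suc δ)) d≤δ)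
  ...   | no-term Σ≡0 unselected = no-term (trans (ΣE-collapse d t g d≤δ r<1+d) Σ≡0) λ where
    (x ∷ i) |x∷i|≤d Ex∷i≡t → let (x≡r , Ei≡q) = digits-of x i t d≤δ |x∷i|≤d Ex∷i≡t in
      unselected i (subst (λ v → ∣ i ∣ᵥ ≤ d ∸ v) x≡r (tail≤ x i |x∷i|≤d)) Ei≡q
  ...   | one-term i |i|≤d∸r Ei≡q Σ≡gi =
    one-term (t % suc δ ∷ i) (cons≤ (t % suc δ) i (N.≤-pred r<1+d) |i|≤d∸r)
             (Equivalence.from (expo-∷-digits (t % suc δ) i t (N.≤-trans (N.≤-pred r<1+d) d≤δ)) (refl , Ei≡q))
             (trans (ΣE-collapse d t g d≤δ r<1+d) Σ≡gi)

module Expansion (B : ℕ) .{{_ : NonZero B}} (d : ℕ → ℕ) where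

  value : ℕ → ℕ
  value M = Σupto M (λ k → d k * B ^ k)

  Digits : ℕ → Set
  Digits M = ∀ k → k ≤ M → d k < B

  value<B^ : ∀ M → Digits M → value M < B ^ suc M
  value<B^ zero    ds = N.*-monoˡ-< 1 (ds 0 z≤n)
  value<B^ (suc M) ds = begin-strict
      value M + d (suc M) * B ^ suc M   <⟨ N.+-monoˡ-< _ (value<B^ M (λ k k≤M → ds k (N.m≤n⇒m≤1+n k≤M))) ⟩
      B ^ suc M + d (suc M) * B ^ suc M ≡⟨⟩
      suc (d (suc M)) * B ^ suc M       ≤⟨ N.*-monoˡ-≤ (B ^ suc M) (ds (suc M) N.≤-refl) ⟩
      B ^ suc (suc M)                   ∎
    where open N.≤-Reasoning

  B^<value : ∀ M → 1 ≤ M → (∀ k → 1 ≤ d k) → B ^ M < value M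
  B^<value (suc M) _ ds = begin-strict
      B ^ suc M                            <⟨ N.+-monoˡ-≤ (B ^ suc M) (N.≤-trans (ds 0) (first≤ M)) ⟩
      value M + B ^ suc M                  ≤⟨ N.+-monoʳ-≤ (value M) (N.m≤n*m (B ^ suc M) (d (suc M)) {{ℕ.>-nonZero (ds (suc M))}}) ⟩
      value M + d (suc M) * B ^ suc M      ∎
    where
      open N.≤-Reasoning
      first≤ : ∀ M → d 0 ≤ value M
      first≤ zero    = N.≤-reflexive (sym (N.*-identityʳ (d 0)))
      first≤ (suc M) = N.≤-trans (first≤ M) (N.m≤m+n _ _)

  value-split : ∀ M N → N ≤ M → ∃ λ H → value M ≡ value N + B ^ suc N * H
  value-split M       N N≤M with N.m≤n⇒m<n∨m≡n N≤M
  value-split M       N N≤M | inj₂ refl = 0 , sym (trans (cong (λ v → value M + v) (N.*-zeroʳ (B ^ suc M))) (N.+-identityʳ _))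
  value-split (suc M) N N≤M | inj₁ N<1+M with value-split M N (N.≤-pred N<1+M)
  ... | H , value≡ = H + d (suc M) * B ^ (M ∸ N) , (begin
      value M + d (suc M) * B ^ suc M
        ≡⟨ cong (_+ d (suc M) * B ^ suc M) value≡ ⟩
      value N + B ^ suc N * H + d (suc M) * B ^ suc M
        ≡⟨ cong (λ v → value N + B ^ suc N * H + d (suc M) * B ^ v) (N.m+[n∸m]≡n N<1+M) ⟨
      value N + B ^ suc N * H + d (suc M) * B ^ (suc N + (M ∸ N))
        ≡⟨ cong (λ v → value N + B ^ suc N * H + d (suc M) * v) (N.^-distribˡ-+-* B (suc N) (M ∸ N)) ⟩
      value N + B ^ suc N * H + d (suc M) * (B ^ suc N * B ^ (M ∸ N))
        ≡⟨ regroup (value N) (B ^ suc N) H (d (suc M)) (B ^ (M ∸ N)) ⟩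
      value N + B ^ suc N * (H + d (suc M) * B ^ (M ∸ N)) ∎)
    where
      open ≡-Reasoning
      regroup : ∀ s b h c e → s + b * h + c * (b * e) ≡ s + b * (h + c * e)
      regroup = NS.solve-∀

  value-below : ∀ N → Digits N → ∃ λ r → r < B ^ N × value N ≡ r + d N * B ^ N
  value-below zero    ds = 0 , s≤s z≤n , refl
  value-below (suc N) ds = value N , value<B^ N (λ k k≤N → ds k (N.m≤n⇒m≤1+n k≤N)) , refl

  digit : ∀ M N .{{_ : NonZero (B ^ N)}} → N ≤ M → Digits M → value M / B ^ N % B ≡ d N
  digit M N N≤M ds with value-split M N N≤M | value-below N (λ k k≤N → ds k (N.≤-trans k≤N N≤M))
  ... | H , value≡ | r , r<B^N , valueN≡ = begin
      value M / B ^ N % B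
        ≡⟨ cong (λ v → v / B ^ N % B) (trans value≡ (cong (_+ B ^ suc N * H) valueN≡)) ⟩
      (r + d N * B ^ N + B ^ suc N * H) / B ^ N % B
        ≡⟨ cong (λ v → v / B ^ N % B) (regroup r (d N) (B ^ N) B H) ⟩
      (r + (d N + H * B) * B ^ N) / B ^ N % B
        ≡⟨ cong (_% B) (/-unique r (d N + H * B) r<B^N) ⟩
      (d N + H * B) % B
        ≡⟨ %-unique (d N) H (ds N N≤M) ⟩
      d N ∎
    where
      open ≡-Reasoning
      regroup : ∀ r c q b h → r + c * q + (b * q) * h ≡ r + (c + h * b) * q
      regroup = NS.solve-∀

exponent<power : ∀ p n → 1 < p → n < p ^ n
exponent<power p zero    1<p = s≤s z≤n
exponent<power p (suc n) 1<p = begin-strict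
    suc n         ≤⟨ exponent<power p n 1<p ⟩
    p ^ n         <⟨ N.m<m*n (p ^ n) p {{N.m^n≢0 p n {{ℕ.>-nonZero (N.<-trans (s≤s z≤n) 1<p)}}}} 1<p ⟩
    p ^ n * p     ≡⟨ N.*-comm (p ^ n) p ⟩
    p ^ suc n     ∎
  where open N.≤-Reasoning

module _ {p q : ℕ} .{{_ : NonZero p}} .{{_ : NonZero q}} .{{_ : NonZero (p * q)}} where

  %-*-factor : ∀ a → a % (p * q) ≡ 0 → a % p ≡ 0
  %-*-factor a a%pq≡0 = trans (sym (m∣n⇒o%n%m≡o%m p (p * q) a (divides q (N.*-comm p q))))
                              (trans (cong (_% p) a%pq≡0) (m<n⇒m%n≡m (ℕ.>-nonZero⁻¹ p)))

  %-*-quotient : ∀ a → a % p ≡ 0 → (a % (p * q) ≡ 0 ⇔ a / p % q ≡ 0)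
  %-*-quotient a a%p≡0 = mk⇔ (λ h → N.m*n≡0⇒m≡0 _ p (trans (sym a%pq) h)) (λ h → trans a%pq (cong (_* p) h))
    where
      instance
        qp≢0 : NonZero (q * p)
        qp≢0 = N.m*n≢0 q p
      a≡ : a ≡ a / p * p
      a≡ = trans (m≡m%n+[m/n]*n a p) (cong (_+ a / p * p) a%p≡0)
      a%pq : a % (p * q) ≡ a / p % q * p
      a%pq = begin
        a % (p * q)             ≡⟨ cong (_% (p * q)) a≡ ⟩
        a / p * p % (p * q)     ≡⟨ %-congʳ (N.*-comm p q) ⟩
        a / p * p % (q * p)     ≡⟨ m%n*o≡m*o%[n*o] (a / p) q p ⟨
        a / p % q * p           ∎
        where open ≡-Reasoning

module Carries (k : ℕ) where
  private
    p : ℕ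
    p = suc k

  -- the two cases of one digit step: the digit sum stays below p, or it does not
  -- (the test `does (p ≤? s)` of carriesAux computes to `k <ᵇ s`)
  no-carry : ∀ f c a b → ¬ (p ≤ a % p + b % p + c) → carriesAux k (suc f) c a b ≡ carriesAux k f 0 (a / p) (b / p)
  no-carry f c a b ¬carry with k ℕ.<ᵇ (a % p + b % p + c) in eq
  ... | true  = ⊥-elim (¬carry (N.<ᵇ⇒< k _ (subst T (sym eq) tt)))
  ... | false = refl

  carry : ∀ f c a b → p ≤ a % p + b % p + c → carriesAux k (suc f) c a b ≡ suc (carriesAux k f 1 (a / p) (b / p))
  carry f c a b carry′ with k ℕ.<ᵇ (a % p + b % p + c) in eq
  ... | true  = refl
  ... | false = ⊥-elim (subst T eq (N.<⇒<ᵇ carry′))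

  carries-0 : ∀ f a → carriesAux k f 0 a 0 ≡ 0
  carries-0 zero    a = refl
  carries-0 (suc f) a = trans (no-carry f 0 a 0 digit-sum) (carries-0 f (a / p))
    where
      digit-sum : ¬ (p ≤ a % p + 0 % p + 0)
      digit-sum h = N.<⇒≱ (m%n<n a p) (subst (p ≤_) (trans (N.+-identityʳ _) (N.+-identityʳ _)) h)

  -- the lowest t digits of c·p^t are 0, so the first t steps produce no carry
  carries-shift : ∀ t f a c .{{_ : NonZero (p ^ t)}} → t ≤ f →
                  carriesAux k f 0 a (c * p ^ t) ≡ carriesAux k (f ∸ t) 0 (a / p ^ t) c
  carries-shift zero    f       a c _ = cong₂ (carriesAux k f 0) (sym (n/1≡n a)) (N.*-identityʳ c)
  carries-shift (suc t) (suc f) a c (s≤s t≤f) = begin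
      carriesAux k (suc f) 0 a (c * (p * p ^ t))
        ≡⟨ cong (carriesAux k (suc f) 0 a) (regroup c p (p ^ t)) ⟩
      carriesAux k (suc f) 0 a (c * p ^ t * p)
        ≡⟨ no-carry f 0 a (c * p ^ t * p) digit-sum ⟩
      carriesAux k f 0 (a / p) (c * p ^ t * p / p)
        ≡⟨ cong (carriesAux k f 0 (a / p)) (m*n/n≡m (c * p ^ t) p) ⟩
      carriesAux k f 0 (a / p) (c * p ^ t)
        ≡⟨ carries-shift t f (a / p) c t≤f ⟩
      carriesAux k (f ∸ t) 0 (a / p / p ^ t) c
        ≡⟨ cong (λ v → carriesAux k (f ∸ t) 0 v c) (m/n/o≡m/[n*o] a p (p ^ t)) ⟩
      carriesAux k (f ∸ t) 0 (a / (p * p ^ t)) c ∎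
    where
      open ≡-Reasoning
      instance
        p^t≢0 : NonZero (p ^ t)
        p^t≢0 = N.m^n≢0 p t
      regroup : ∀ c p q → c * (p * q) ≡ c * q * p
      regroup = NS.solve-∀
      digit-sum : ¬ (p ≤ a % p + (c * p ^ t * p) % p + 0)
      digit-sum h = N.<⇒≱ (m%n<n a p) (subst (p ≤_) low-digit h)
        where
          low-digit : a % p + (c * p ^ t * p) % p + 0 ≡ a % p
          low-digit = trans (N.+-identityʳ _) (trans (cong (λ v → a % p + v) (m*n%n≡0 (c * p ^ t) p)) (N.+-identityʳ _))

  ones-∷ : ∀ e → p ^ suc e ∸ 1 ≡ k + (p ^ e ∸ 1) * p
  ones-∷ e with p ^ e | N.m^n>0 p e
  ... | suc P | _ = rearrange k P
    where
      rearrange : ∀ k P → P + k * suc P ≡ k + P * suc k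
      rearrange = NS.solve-∀

  -- Adding p^e - 1 (e digits k) to a produces no carry iff the lowest e digits of a vanish:
  -- a nonzero lowest digit of a carries at once, a zero one passes the digit k through.
  carries-ones : ∀ e f a .{{_ : NonZero (p ^ e)}} → e ≤ f → (carriesAux k f 0 a (p ^ e ∸ 1) ≡ 0 ⇔ a % p ^ e ≡ 0)
  carries-ones zero    f       a _          = mk⇔ (λ _ → n%1≡0 a) (λ _ → carries-0 f a)
  carries-ones (suc e) (suc f) a (s≤s e≤f) = by-last-digit (a % p N.≟ 0)
    where
      instance
        p^e≢0 : NonZero (p ^ e)
        p^e≢0 = N.m^n≢0 p e
      ones = k + (p ^ e ∸ 1) * p
      ones%p : ones % p ≡ k
      ones%p = %-unique k (p ^ e ∸ 1) (N.n<1+n k)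
      by-last-digit : Dec (a % p ≡ 0) → (carriesAux k (suc f) 0 a (p ^ suc e ∸ 1) ≡ 0 ⇔ a % p ^ suc e ≡ 0)
      by-last-digit (yes a%p≡0) = begin
          carriesAux k (suc f) 0 a (p ^ suc e ∸ 1) ≡ 0
            ≡⟨ cong (λ b → carriesAux k (suc f) 0 a b ≡ 0) (ones-∷ e) ⟩
          carriesAux k (suc f) 0 a ones ≡ 0
            ≡⟨ cong (_≡ 0) (no-carry f 0 a ones (λ h → N.<-irrefl refl (subst (p ≤_) digit-sum h))) ⟩
          carriesAux k f 0 (a / p) (ones / p) ≡ 0
            ≡⟨ cong (λ b → carriesAux k f 0 (a / p) b ≡ 0) (/-unique k (p ^ e ∸ 1) (N.n<1+n k)) ⟩
          carriesAux k f 0 (a / p) (p ^ e ∸ 1) ≡ 0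
            ≈⟨ carries-ones e f (a / p) e≤f ⟩
          a / p % p ^ e ≡ 0
            ≈⟨ %-*-quotient {p} {p ^ e} a a%p≡0 ⟨
          a % p ^ suc e ≡ 0 ∎
        where
          open import Relation.Binary.Reasoning.Setoid (⇔-setoid 0ℓ)
          digit-sum : a % p + ones % p + 0 ≡ k
          digit-sum = trans (N.+-identityʳ _) (cong₂ _+_ a%p≡0 ones%p)
      by-last-digit (no a%p≢0) = mk⇔ (λ carries≡0 → ⊥-elim (N.1+n≢0 (trans (sym first-carry) carries≡0)))
                                     (λ a%p^e≡0 → ⊥-elim (a%p≢0 (%-*-factor {p} {p ^ e} a a%p^e≡0)))
        where
          digit-sum : p ≤ a % p + ones % p + 0
          digit-sum = subst (p ≤_) (sym (trans (N.+-identityʳ _) (cong (λ v → a % p + v) ones%p)))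
                            (N.+-monoˡ-≤ k (N.n≢0⇒n>0 a%p≢0))
          first-carry : carriesAux k (suc f) 0 a (p ^ suc e ∸ 1) ≡ suc (carriesAux k f 1 (a / p) (ones / p))
          first-carry = trans (cong (carriesAux k (suc f) 0 a) (ones-∷ e)) (carry f 0 a ones digit-sum)

-- The fuel a + b + 1 given to τ covers the T + e lowest digit positions of
-- b = (p^e - 1)·p^T that matter.
fuel-bound : ∀ p e T → 1 < p → 1 ≤ e → T + e ≤ (p ^ e ∸ 1) * p ^ T
fuel-bound p e T 1<p 1≤e = begin
    T + e           ≤⟨ N.+-mono-≤ (N.m≤n*m T x {{ℕ.>-nonZero (N.≤-trans 1≤e e≤x)}}) e≤x ⟩
    x * T + x       ≡⟨ N.+-comm (x * T) x ⟩
    x + x * T       ≡⟨ N.*-suc x T ⟨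
    x * suc T       ≤⟨ N.*-monoʳ-≤ x (exponent<power p T 1<p) ⟩
    x * p ^ T       ∎
  where
    open N.≤-Reasoning
    x = p ^ e ∸ 1
    e≤x : e ≤ x
    e≤x = N.m+n≤o⇒m≤o∸n e (subst (_≤ p ^ e) (N.+-comm 1 e) (exponent<power p e 1<p))

τ-block : ∀ {p X Q} a → 1 < p → X ∈ p ↑ → Q ∈ p ↑ → .{{_ : NonZero X}} .{{_ : NonZero Q}} →
          (τ p a ((X ∸ 1) * Q) ≡ 0 ⇔ a / Q % X ≡ 0)
τ-block {suc zero} a (s≤s ()) _ _
τ-block {suc (suc j)} a _ (zero , refl) (T , refl) = mk⇔ (λ _ → n%1≡0 (a / suc (suc j) ^ T)) (λ _ → carries-0 (a + 0 + 1) a)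
  where open Carries (suc j)
τ-block {suc (suc j)} a 1<p (suc e , refl) (T , refl) =
  subst (λ c → (c ≡ 0) ⇔ (a / p ^ T % p ^ suc e ≡ 0)) (sym (carries-shift T f a (p ^ suc e ∸ 1) T≤f))
        (carries-ones (suc e) (f ∸ T) (a / p ^ T) e≤f∸T)
  where
    open Carries (suc j)
    p = suc (suc j)
    f = a + (p ^ suc e ∸ 1) * p ^ T + 1
    T+e≤f : T + suc e ≤ f
    T+e≤f = N.≤-trans (fuel-bound p (suc e) T 1<p (s≤s z≤n)) (N.≤-trans (N.m≤n+m _ a) (N.m≤m+n _ 1))
    T≤f : T ≤ f
    T≤f = N.m+n≤o⇒m≤o T T+e≤f
    e≤f∸T : suc e ≤ f ∸ T
    e≤f∸T = N.m+n≤o⇒m≤o∸n (suc e) (subst (_≤ f) (N.+-comm T (suc e)) T+e≤f)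

offset : ℕ → ℤ → ℕ
offset X (+ c)      = X + c
offset X -[1+ c ]   = X ∸ suc c

offset-≡ : ∀ X C → ∣ C ∣ < X → + offset X C ≡ + X ℤ.+ C
offset-≡ X (+ c)    _     = sym (Z.pos-+ X c)
offset-≡ X -[1+ c ] c<X   = sym (Z.⊖-≥ (N.<⇒≤ c<X))

offset-positive : ∀ X C → ∣ C ∣ < X → 1 ≤ offset X C
offset-positive X (+ c)    c<X = N.≤-trans (N.≤-trans (s≤s z≤n) c<X) (N.m≤m+n X c)
offset-positive X -[1+ c ] c<X = N.m<n⇒0<n∸m c<X

offset<2X : ∀ X C → ∣ C ∣ < X → offset X C < X + X
offset<2X X (+ c)    c<X = N.+-monoʳ-< X c<X
offset<2X X -[1+ c ] c<X = N.<-≤-trans (N.∸-monoʳ-< {X} {suc c} {0} (s≤s z≤n) (N.<⇒≤ c<X)) (N.m≤m+n X X)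

offset-%-X : ∀ X C .{{_ : NonZero X}} → ∣ C ∣ < X → (offset X C % X ≡ 0 ⇔ C ≡ + 0)
offset-%-X X (+ c) c<X = mk⇔
  (λ X+c%X≡0 → cong +_ (trans (sym X+c%X≡c) X+c%X≡0))
  (λ { refl → trans (cong (_% X) (N.+-identityʳ X)) (n%n≡0 X) })
  where
    X+c%X≡c : (X + c) % X ≡ c
    X+c%X≡c = trans (cong (_% X) (N.+-comm X c)) (trans ([m+n]%n≡m%n c X) (m<n⇒m%n≡m c<X))
offset-%-X X -[1+ c ] c<X = mk⇔ (λ X∸c%X≡0 → ⊥-elim (N.<⇒≢ (N.m<n⇒0<n∸m c<X) (sym (trans (sym (m<n⇒m%n≡m X∸c<X)) X∸c%X≡0)))) (λ ())
  where
    X∸c<X : X ∸ suc c < X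
    X∸c<X = N.∸-monoʳ-< {X} {suc c} {0} (s≤s z≤n) (N.<⇒≤ c<X)

*-^ : ∀ x y n → (x * y) ^ n ≡ x ^ n * y ^ n
*-^ x y zero    = refl
*-^ x y (suc n) = trans (cong (x * y *_) (*-^ x y n)) (regroup x y (x ^ n) (y ^ n))
  where
    regroup : ∀ a b c d → a * b * (c * d) ≡ a * c * (b * d)
    regroup = NS.solve-∀

Πℕ-power-split : ∀ {k} (f h j : Fin k → ℕ) B → Πℕ (λ s → (f s * B ^ h s) ^ j s) ≡ Πℕ (λ s → f s ^ j s) * B ^ Σℕ (λ s → j s * h s)
Πℕ-power-split {zero}  f h j B = refl
Πℕ-power-split {suc k} f h j B = begin
    (f₀ * B ^ h₀) ^ j₀ * Πℕ (λ s → (f (F.suc s) * B ^ h (F.suc s)) ^ j (F.suc s))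
      ≡⟨ cong₂ _*_ (*-^ f₀ (B ^ h₀) j₀) (Πℕ-power-split (f ∘ F.suc) (h ∘ F.suc) (j ∘ F.suc) B) ⟩
    f₀ ^ j₀ * (B ^ h₀) ^ j₀ * (P * B ^ S)
      ≡⟨ cong (λ v → f₀ ^ j₀ * v * (P * B ^ S)) (trans (N.^-*-assoc B h₀ j₀) (cong (B ^_) (N.*-comm h₀ j₀))) ⟩
    f₀ ^ j₀ * B ^ (j₀ * h₀) * (P * B ^ S)
      ≡⟨ regroup (f₀ ^ j₀) (B ^ (j₀ * h₀)) P (B ^ S) ⟩
    f₀ ^ j₀ * P * (B ^ (j₀ * h₀) * B ^ S)
      ≡⟨ cong (f₀ ^ j₀ * P *_) (N.^-distribˡ-+-* B (j₀ * h₀) S) ⟨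
    f₀ ^ j₀ * P * B ^ (j₀ * h₀ + S) ∎
  where
    open ≡-Reasoning
    f₀ = f F.zero
    h₀ = h F.zero
    j₀ = j F.zero
    P = Πℕ (λ s → f (F.suc s) ^ j (F.suc s))
    S = Σℕ (λ s → j (F.suc s) * h (F.suc s))
    regroup : ∀ a b c d → a * b * (c * d) ≡ a * c * (b * d)
    regroup = NS.solve-∀

shifted≡⇒ : ∀ e f n k → f ≤ n → e + (n ∸ f) ≡ k → f ≡ n + e ∸ k
shifted≡⇒ e f n k f≤n refl = sym (begin
    n + e ∸ (e + (n ∸ f))               ≡⟨ cong (_∸ (e + (n ∸ f))) n+e≡ ⟩
    e + (n ∸ f) + f ∸ (e + (n ∸ f))     ≡⟨ N.m+n∸m≡n (e + (n ∸ f)) f ⟩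
    f ∎)
  where
    open ≡-Reasoning
    n+e≡ : n + e ≡ e + (n ∸ f) + f
    n+e≡ = trans (cong (_+ e) (sym (N.m∸n+n≡m f≤n))) (regroup (n ∸ f) f e)
      where
        regroup : ∀ x f e → x + f + e ≡ e + x + f
        regroup = NS.solve-∀

shifted≡n⇔ : ∀ e f n → f ≤ n → (e + (n ∸ f) ≡ n ⇔ f ≡ e)
shifted≡n⇔ e f n f≤n = mk⇔ (λ h → trans (shifted≡⇒ e f n n f≤n h) (N.m+n∸m≡n n e))
                           (λ { refl → N.m+[n∸m]≡n f≤n })

sumL-upTo≡Σupto : ∀ M (f : ℕ → ℕ) → sumL (upTo (suc M)) (λ k → + f k) ≡ + Σupto M f
sumL-upTo≡Σupto zero    f = Z.+-identityʳ (+ f 0)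
sumL-upTo≡Σupto (suc M) f = trans (sumL-upTo-suc (suc M) (λ k → + f k)) (cong (ℤ._+ + f (suc M)) (sumL-upTo≡Σupto M f))

-- The coefficients C_k of K in base B (before adding the offset X to each digit).
module Construction (ν δ B : ℕ) (z : Vec ℕ (suc ν)) (a : Vec ℕ (suc ν) → ℤ) where
  open Exponents δ

  I : List (Vec ℕ (suc ν))
  I = multiIdx (suc ν) δ

  I-bounded : All (λ i → ∣ i ∣ᵥ ≤ δ) I
  I-bounded = multiIdx-bounded (suc ν) δ

  nν N M : ℕ
  nν = nIdx δ ν
  N  = nIdx δ (suc ν)
  M  = (2 * δ + 1) * nν

  g : Vec ℕ (suc ν) → ℤ
  g i = + weight δ i ℤ.* a i

  -- A_j = (δ choose j) z^j, the coefficient of B^{E(j)} in c^δ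
  A : Vec ℕ (suc ν) → ℕ
  A j = multinomial δ j * monomial (lookup z) j

  -- the exponent of B in the product of the j-th term of c^δ and the i-th term of the sum
  shifted : Vec ℕ (suc ν) → Vec ℕ (suc ν) → ℕ
  shifted j i = expo j + (N ∸ expo i)

  inner : Vec ℕ (suc ν) → ℕ → ℤ
  inner j k = sumL I (λ i → when (shifted j i N.≟ k) (g i))

  C : ℕ → ℤ
  C k = sumL I (λ j → + A j ℤ.* inner j k)

  expo≤δnν : ∀ i → ∣ i ∣ᵥ ≤ δ → expo i ≤ δ * nν
  expo≤δnν i |i|≤δ = begin
      expo i                                ≤⟨ Σℕ-mono {suc ν} (λ s → N.*-monoʳ-≤ (lookup i s) (N.^-monoʳ-≤ (suc δ) (FP.toℕ≤pred[n] s))) ⟩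
      Σℕ (λ s → lookup i s * nν)            ≡⟨ Σℕ-*ʳ (lookup i) nν ⟩
      ∣ i ∣ᵥ * nν                           ≤⟨ N.*-monoˡ-≤ nν |i|≤δ ⟩
      δ * nν                                ∎
    where open N.≤-Reasoning

  expo≤N : ∀ i → ∣ i ∣ᵥ ≤ δ → expo i ≤ N
  expo≤N i |i|≤δ = N.≤-trans (expo≤δnν i |i|≤δ) (N.m≤n+m (δ * nν) nν)

  M≡δnν+N : M ≡ δ * nν + N
  M≡δnν+N = rearrange δ nν
    where
      rearrange : ∀ d n → (2 * d + 1) * n ≡ d * n + (n + d * n)
      rearrange = NS.solve-∀

  N≤M : N ≤ M
  N≤M = subst (N ≤_) (sym M≡δnν+N) (N.m≤n+m N (δ * nν))

  1≤M : 1 ≤ M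
  1≤M = N.≤-trans (N.m^n>0 (suc δ) (suc ν)) N≤M

  shifted≤M : ∀ j i → ∣ j ∣ᵥ ≤ δ → shifted j i ≤ M
  shifted≤M j i |j|≤δ = subst (shifted j i ≤_) (sym M≡δnν+N) (N.+-mono-≤ (expo≤δnν j |j|≤δ) (N.m∸n≤m N (expo i)))

  c^δ-expansion : cVal ν δ B z ^ δ ≡ Σⁿ I (λ j → A j * B ^ expo j)
  c^δ-expansion = trans (multinomial-theorem (suc ν) δ (λ s → lookup z s * B ^ nIdx δ (toℕ s)))
    (ℕΣ.sumL-cong I (λ j → trans (cong (multinomial δ j *_) (Πℕ-power-split (lookup z) (λ s → nIdx δ (toℕ s)) (lookup j) B))
                                 (sym (N.*-assoc (multinomial δ j) (monomial (lookup z) j) (B ^ expo j)))))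

  expansion : + (cVal ν δ B z ^ δ) ℤ.* sumL I (λ i → g i ℤ.* + (B ^ (N ∸ expo i)))
              ≡ sumL (upTo (suc M)) (λ k → C k ℤ.* + (B ^ k))
  expansion = begin
      + (cVal ν δ B z ^ δ) ℤ.* S
        ≡⟨ cong (λ v → v ℤ.* S) (trans (cong +_ c^δ-expansion) (sym (sumL-+ₙ I _))) ⟩
      sumL I (λ j → + (A j * B ^ expo j)) ℤ.* S
        ≡⟨ sumL-*ʳ S I _ ⟩
      sumL I (λ j → + (A j * B ^ expo j) ℤ.* S)
        ≡⟨ sumL-congᴬ I-bounded (λ j |j|≤δ → per-j j |j|≤δ) ⟩
      sumL I (λ j → sumL U (λ k → + A j ℤ.* inner j k ℤ.* + (B ^ k)))
        ≡⟨ sumL-swap I U _ ⟩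
      sumL U (λ k → sumL I (λ j → + A j ℤ.* inner j k ℤ.* + (B ^ k)))
        ≡⟨ sumL-cong U (λ k → sym (sumL-*ʳ (+ (B ^ k)) I _)) ⟩
      sumL U (λ k → C k ℤ.* + (B ^ k)) ∎
    where
      open ≡-Reasoning
      S = sumL I (λ i → g i ℤ.* + (B ^ (N ∸ expo i)))
      U = upTo (suc M)
      merge : ∀ j i → + (B ^ expo j) ℤ.* (g i ℤ.* + (B ^ (N ∸ expo i))) ≡ g i ℤ.* + (B ^ shifted j i)
      merge j i = begin
        + (B ^ expo j) ℤ.* (g i ℤ.* + (B ^ (N ∸ expo i)))      ≡⟨ swap (+ (B ^ expo j)) (g i) _ ⟩
        g i ℤ.* (+ (B ^ expo j) ℤ.* + (B ^ (N ∸ expo i)))      ≡⟨ cong (g i ℤ.*_) (sym (Z.pos-* (B ^ expo j) _)) ⟩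
        g i ℤ.* + (B ^ expo j * B ^ (N ∸ expo i))              ≡⟨ cong (λ v → g i ℤ.* + v) (N.^-distribˡ-+-* B (expo j) _) ⟨
        g i ℤ.* + (B ^ shifted j i) ∎
        where
          swap : ∀ x y w → x ℤ.* (y ℤ.* w) ≡ y ℤ.* (x ℤ.* w)
          swap = ZS.solve-∀
      per-j : ∀ j → ∣ j ∣ᵥ ≤ δ → + (A j * B ^ expo j) ℤ.* S ≡ sumL U (λ k → + A j ℤ.* inner j k ℤ.* + (B ^ k))
      per-j j |j|≤δ = begin
        + (A j * B ^ expo j) ℤ.* S
          ≡⟨ cong (ℤ._* S) (Z.pos-* (A j) (B ^ expo j)) ⟩
        + A j ℤ.* + (B ^ expo j) ℤ.* S
          ≡⟨ Z.*-assoc (+ A j) _ S ⟩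
        + A j ℤ.* (+ (B ^ expo j) ℤ.* S)
          ≡⟨ cong (+ A j ℤ.*_) (trans (sumL-*ˡ (+ (B ^ expo j)) I (λ i → g i ℤ.* + (B ^ (N ∸ expo i)))) (sumL-cong I (merge j))) ⟩
        + A j ℤ.* sumL I (λ i → g i ℤ.* + (B ^ shifted j i))
          ≡⟨ cong (+ A j ℤ.*_) (sumL-collect I (shifted j) g (λ k → + (B ^ k)) M
                                  (All.tabulate (λ {i} _ → shifted≤M j i |j|≤δ))) ⟩
        + A j ℤ.* sumL U (λ k → inner j k ℤ.* + (B ^ k))
          ≡⟨ sumL-*ˡ (+ A j) U _ ⟩
        sumL U (λ k → + A j ℤ.* (inner j k ℤ.* + (B ^ k)))
          ≡⟨ sumL-cong U (λ k → sym (Z.*-assoc (+ A j) _ _)) ⟩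
        sumL U (λ k → + A j ℤ.* inner j k ℤ.* + (B ^ k)) ∎

  inner-selected : ∀ j k → inner j k ≡ ΣE δ (N + expo j ∸ k) (λ i → when (shifted j i N.≟ k) (g i))
  inner-selected j k = sumL-congᴬ I-bounded λ i |i|≤δ →
    when-implied (shifted j i N.≟ k) (expo i N.≟ N + expo j ∸ k) (g i) (shifted≡⇒ (expo j) (expo i) N k (expo≤N i |i|≤δ))

  module _ {L : ℕ} (a-bound : ∀ i → ∣ i ∣ᵥ ≤ δ → ∣ a i ∣ ≤ L) where

    g-bound : ∀ i → ∣ i ∣ᵥ ≤ δ → ∣ g i ∣ ≤ δ ! * L
    g-bound i |i|≤δ = subst (_≤ δ ! * L) (sym (Z.abs-* (+ weight δ i) (a i)))
                            (N.*-mono-≤ (weight≤factorial δ i |i|≤δ) (a-bound i |i|≤δ))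

    -- at most one term survives in inner j k, so it is bounded like a single g_i
    inner-bound : ∀ j k → ∣ inner j k ∣ ≤ δ ! * L
    inner-bound j k = subst (λ v → ∣ v ∣ ≤ δ ! * L) (sym (inner-selected j k)) (bound (selection δ t g′ N.≤-refl))
      where
        t = N + expo j ∸ k
        g′ = λ i → when (shifted j i N.≟ k) (g i)
        bound : Selection δ t g′ → ∣ ΣE δ t g′ ∣ ≤ δ ! * L
        bound (no-term Σ≡0 _)          = subst (λ v → ∣ v ∣ ≤ δ ! * L) (sym Σ≡0) z≤n
        bound (one-term i |i|≤δ _ Σ≡g′i) = subst (λ v → ∣ v ∣ ≤ δ ! * L) (sym Σ≡g′i)
                                                 (N.≤-trans (∣when∣≤ (shifted j i N.≟ k) (g i)) (g-bound i |i|≤δ))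

    C-bound : ∀ k → ∣ C k ∣ ≤ δ ! * L * (1 + ∣ z ∣ᵥ) ^ δ
    C-bound k = begin
        ∣ C k ∣                                ≤⟨ sumL-abs I _ ⟩
        Σⁿ I (λ j → ∣ + A j ℤ.* inner j k ∣)   ≡⟨ ℕΣ.sumL-cong I (λ j → Z.abs-* (+ A j) (inner j k)) ⟩
        Σⁿ I (λ j → A j * ∣ inner j k ∣)        ≤⟨ Σⁿ-monoᴬ I-bounded (λ j _ → N.*-monoʳ-≤ (A j) (inner-bound j k)) ⟩
        Σⁿ I (λ j → A j * (δ ! * L))           ≡⟨ ℕΣ.sumL-*ʳ (δ ! * L) I A ⟨
        Σⁿ I A * (δ ! * L)                     ≡⟨ cong (_* (δ ! * L)) (multinomial-theorem (suc ν) δ (lookup z)) ⟨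
        (1 + ∣ z ∣ᵥ) ^ δ * (δ ! * L)           ≡⟨ N.*-comm _ (δ ! * L) ⟩
        δ ! * L * (1 + ∣ z ∣ᵥ) ^ δ             ∎
      where open N.≤-Reasoning

  inner-middle : ∀ j → ∣ j ∣ᵥ ≤ δ → inner j N ≡ g j
  inner-middle j |j|≤δ = trans (sumL-congᴬ I-bounded diagonal) (from-selection (selection δ (expo j) g N.≤-refl))
    where
      diagonal : ∀ i → ∣ i ∣ᵥ ≤ δ → when (shifted j i N.≟ N) (g i) ≡ when (expo i N.≟ expo j) (g i)
      diagonal i |i|≤δ = when-⇔ (shifted j i N.≟ N) (expo i N.≟ expo j) (g i) (shifted≡n⇔ (expo j) (expo i) N (expo≤N i |i|≤δ))
      from-selection : Selection δ (expo j) g → ΣE δ (expo j) g ≡ g j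
      from-selection (no-term _ unselected)       = ⊥-elim (unselected j |j|≤δ refl)
      from-selection (one-term i |i|≤δ Ei≡Ej Σ≡gi) = trans Σ≡gi (cong g (expo-injective i j |i|≤δ |j|≤δ Ei≡Ej))

  -- C_N = Σ_j A_j w_j a_j = δ!·P(z), since A_j w_j = δ! z^j
  C-middle : C N ≡ + (δ !) ℤ.* evalP ν δ a z
  C-middle = begin
      C N
        ≡⟨ sumL-congᴬ I-bounded (λ j |j|≤δ → trans (cong (+ A j ℤ.*_) (inner-middle j |j|≤δ)) (term j |j|≤δ)) ⟩
      sumL I (λ j → + (δ !) ℤ.* (a j ℤ.* + monomial (lookup z) j))
        ≡⟨ sumL-*ˡ (+ (δ !)) I _ ⟨
      + (δ !) ℤ.* sumL I (λ j → a j ℤ.* + monomial (lookup z) j)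
        ≡⟨ cong (+ (δ !) ℤ.*_) (Σℤ≡sumL I _) ⟨
      + (δ !) ℤ.* evalP ν δ a z ∎
    where
      open ≡-Reasoning
      term : ∀ j → ∣ j ∣ᵥ ≤ δ → + A j ℤ.* g j ≡ + (δ !) ℤ.* (a j ℤ.* + monomial (lookup z) j)
      term j |j|≤δ = begin
          + A j ℤ.* (+ w ℤ.* a j)   ≡⟨ Z.*-assoc (+ A j) (+ w) (a j) ⟨
          + A j ℤ.* + w ℤ.* a j     ≡⟨ cong (ℤ._* a j) (Z.pos-* (A j) w) ⟨
          + (A j * w) ℤ.* a j       ≡⟨ cong (λ v → + v ℤ.* a j) A·w≡ ⟩
          + (δ ! * m) ℤ.* a j       ≡⟨ cong (ℤ._* a j) (Z.pos-* (δ !) m) ⟩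
          + (δ !) ℤ.* + m ℤ.* a j   ≡⟨ regroup (+ (δ !)) (+ m) (a j) ⟩
          + (δ !) ℤ.* (a j ℤ.* + m) ∎
        where
          w = weight δ j
          m = monomial (lookup z) j
          A·w≡ : multinomial δ j * m * w ≡ δ ! * m
          A·w≡ = trans (swap (multinomial δ j) m w) (cong (_* m) (multinomial-weight δ j |j|≤δ))
            where
              swap : ∀ x y u → x * y * u ≡ x * u * y
              swap = NS.solve-∀
          regroup : ∀ x y u → x ℤ.* y ℤ.* u ≡ x ℤ.* (u ℤ.* y)
          regroup = ZS.solve-∀

  K-expansion : ∀ X → (∀ k → ∣ C k ∣ < X) → KVal ν δ B X a z ≡ + Σupto M (λ k → offset X (C k) * B ^ k)
  K-expansion X C<X = begin
      KVal ν δ B X a z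
        ≡⟨ cong₂ ℤ._+_ (trans (cong (+ (cVal ν δ B z ^ δ) ℤ.*_) (Σℤ≡sumL I _)) expansion) offset-part ⟩
      sumL U (λ k → C k ℤ.* + (B ^ k)) ℤ.+ sumL U (λ k → + X ℤ.* + (B ^ k))
        ≡⟨ sumL-+ U (λ k → C k ℤ.* + (B ^ k)) (λ k → + X ℤ.* + (B ^ k)) ⟨
      sumL U (λ k → C k ℤ.* + (B ^ k) ℤ.+ + X ℤ.* + (B ^ k))
        ≡⟨ sumL-cong U digit ⟩
      sumL U (λ k → + (offset X (C k) * B ^ k))
        ≡⟨ sumL-upTo≡Σupto M (λ k → offset X (C k) * B ^ k) ⟩
      + Σupto M (λ k → offset X (C k) * B ^ k) ∎
    where
      open ≡-Reasoning
      U = upTo (suc M)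
      offset-part : + (X * Σupto M (B ^_)) ≡ sumL U (λ k → + X ℤ.* + (B ^ k))
      offset-part = trans (Z.pos-* X _) (trans (cong (+ X ℤ.*_) (sym (sumL-upTo≡Σupto M (B ^_)))) (sumL-*ˡ (+ X) U (λ k → + (B ^ k))))
      digit : ∀ k → C k ℤ.* + (B ^ k) ℤ.+ + X ℤ.* + (B ^ k) ≡ + (offset X (C k) * B ^ k)
      digit k = begin
          C k ℤ.* + (B ^ k) ℤ.+ + X ℤ.* + (B ^ k)   ≡⟨ Z.*-distribʳ-+ (+ (B ^ k)) (C k) (+ X) ⟨
          (C k ℤ.+ + X) ℤ.* + (B ^ k)               ≡⟨ cong (ℤ._* + (B ^ k)) (trans (Z.+-comm (C k) (+ X)) (sym (offset-≡ X (C k) (C<X k)))) ⟩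
          + offset X (C k) ℤ.* + (B ^ k)            ≡⟨ Z.pos-* (offset X (C k)) (B ^ k) ⟨
          + (offset X (C k) * B ^ k)                ∎

  P≡0⇔C-middle≡0 : evalP ν δ a z ≡ + 0 ⇔ C N ≡ + 0
  P≡0⇔C-middle≡0 = mk⇔ (λ P≡0 → trans C-middle (trans (cong (+ (δ !) ℤ.*_) P≡0) (Z.*-zeroʳ (+ (δ !)))))
                        (λ CN≡0 → δ!-cancel (Z.i*j≡0⇒i≡0∨j≡0 (+ (δ !)) (trans (sym C-middle) CN≡0)))
    where
      δ!-cancel : + (δ !) ≡ + 0 ⊎ evalP ν δ a z ≡ + 0 → evalP ν δ a z ≡ + 0
      δ!-cancel (inj₁ δ!≡0) = ⊥-elim (N.<⇒≢ (N.1≤n! δ) (sym (cong ∣_∣ δ!≡0)))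
      δ!-cancel (inj₂ P≡0)  = P≡0

  -- With |C_k| < X, 2X ≤ B and X ∣ B the digits X + C_k of K lie in [1, B): this
  -- bounds K, and the N-th digit, ≡ C_N (mod X), is divisible by X iff P(z) = 0.
  module Digits-of-K (X : ℕ) .{{_ : NonZero X}} .{{_ : NonZero B}}
                     (C<X : ∀ k → ∣ C k ∣ < X) (2X≤B : X + X ≤ B) (X∣B : X ∣ B) where
    open Expansion B (λ k → offset X (C k))

    instance
      B^N≢0 : NonZero (B ^ N)
      B^N≢0 = N.m^n≢0 B N

    digits : Digits M
    digits k _ = N.<-≤-trans (offset<2X X (C k) (C<X k)) 2X≤B

    K≡ : KVal ν δ B X a z ≡ + value M
    K≡ = K-expansion X C<X

    K-lower : + (B ^ M) ℤ.< KVal ν δ B X a z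
    K-lower = subst (+ (B ^ M) ℤ.<_) (sym K≡) (ℤ.+<+ (B^<value M 1≤M (λ k → offset-positive X (C k) (C<X k))))

    K-upper : KVal ν δ B X a z ℤ.< + (B ^ (M + 1))
    K-upper = subst₂ ℤ._<_ (sym K≡) (cong (λ e → + (B ^ e)) (N.+-comm 1 M)) (ℤ.+<+ (value<B^ M digits))

    P≡0⇔X∣middle-digit : evalP ν δ a z ≡ + 0 ⇔ ∣ KVal ν δ B X a z ∣ / B ^ N % X ≡ 0
    P≡0⇔X∣middle-digit = begin
        evalP ν δ a z ≡ + 0                    ≈⟨ P≡0⇔C-middle≡0 ⟩
        C N ≡ + 0                              ≈⟨ offset-%-X X (C N) (C<X N) ⟨
        offset X (C N) % X ≡ 0                 ≡⟨ cong (_≡ 0) middle-digit-mod-X ⟨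
        value M / B ^ N % X ≡ 0                ≡⟨ cong (λ K → ∣ K ∣ / B ^ N % X ≡ 0) K≡ ⟨
        ∣ KVal ν δ B X a z ∣ / B ^ N % X ≡ 0   ∎
      where
        open import Relation.Binary.Reasoning.Setoid (⇔-setoid 0ℓ)
        middle-digit-mod-X : value M / B ^ N % X ≡ offset X (C N) % X
        middle-digit-mod-X = trans (sym (m∣n⇒o%n%m≡o%m X B _ X∣B)) (cong (_% X) (digit M N N≤M digits))

power-divides : ∀ {p X B} → 1 < p → X ∈ p ↑ → B ∈ p ↑ → X < B → X * p ∣ B
power-divides {p@(suc p′)} 1<p (e , refl) (m , refl) X<B = divides (p ^ (m ∸ suc e)) (begin
    p ^ m                          ≡⟨ cong (p ^_) (N.m+[n∸m]≡n e<m) ⟨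
    p ^ (suc e + (m ∸ suc e))      ≡⟨ N.^-distribˡ-+-* p (suc e) (m ∸ suc e) ⟩
    p * p ^ e * p ^ (m ∸ suc e)    ≡⟨ N.*-comm (p * p ^ e) _ ⟩
    p ^ (m ∸ suc e) * (p * p ^ e)  ≡⟨ cong (p ^ (m ∸ suc e) *_) (N.*-comm p (p ^ e)) ⟩
    p ^ (m ∸ suc e) * (p ^ e * p)  ∎)
  where
    open ≡-Reasoning
    e<m : e < m
    e<m = N.≰⇒> (λ m≤e → N.<⇒≱ X<B (N.^-monoʳ-≤ p m≤e))

power-gap : ∀ {p X B} → 1 < p → X ∈ p ↑ → B ∈ p ↑ → X < B → X ∣ B × X + X ≤ B
power-gap {p@(suc p′)} {X} {B} 1<p X∈p↑ B∈p↑@(m , refl) X<B = ∣-trans (m∣m*n p) Xp∣B , (begin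
    X + X         ≡⟨ cong (λ v → X + v) (N.+-identityʳ X) ⟨
    2 * X         ≤⟨ N.*-monoˡ-≤ X 1<p ⟩
    p * X         ≡⟨ N.*-comm p X ⟩
    X * p         ≤⟨ ∣⇒≤ {{N.m^n≢0 p m}} Xp∣B ⟩
    B             ∎)
  where
    open N.≤-Reasoning
    Xp∣B : X * p ∣ B
    Xp∣B = power-divides 1<p X∈p↑ B∈p↑ X<B

power-^ : ∀ {p B} n → B ∈ p ↑ → (B ^ n) ∈ p ↑
power-^ {p} n (m , refl) = m * n , N.^-*-assoc p m n

-- The theorem.

lemma2p4 : (ν δ L p B X : ℕ) (z : Vec ℕ (suc ν)) (a : Vec ℕ (suc ν) → ℤ) →
    1 ≤ δ → 1 ≤ L →
    (∀ i → ∣ i ∣ᵥ ≤ δ → ∣ a i ∣ ≤ L) →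
    1 < p → B ∈ p ↑ → X ∈ p ↑ →
    X < B → (δ ! * L * (1 + ∣ z ∣ᵥ) ^ δ) < X →
    (+ (B ^ ((2 * δ + 1) * nIdx δ ν)) ℤ.< KVal ν δ B X a z)
    × (KVal ν δ B X a z ℤ.< + (B ^ ((2 * δ + 1) * nIdx δ ν + 1)))
    × (evalP ν δ a z ≡ + 0 ⇔ τ p ∣ KVal ν δ B X a z ∣ ((X ∸ 1) * B ^ nIdx δ (suc ν)) ≡ 0)
lemma2p4 ν δ L p B X z a _ _ a-bound 1<p B∈p↑ X∈p↑ X<B bound<X = K-lower , K-upper , criterion
  where
    open Construction ν δ B z a
    instance
      X≢0 : NonZero X
      X≢0 = ℕ.>-nonZero (N.≤-<-trans z≤n bound<X)
      B≢0 : NonZero B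
      B≢0 = ℕ.>-nonZero (N.<-trans (ℕ.>-nonZero⁻¹ X) X<B)
    C<X : ∀ k → ∣ C k ∣ < X
    C<X k = N.≤-<-trans (C-bound a-bound k) bound<X
    gap : X ∣ B × X + X ≤ B
    gap = power-gap 1<p X∈p↑ B∈p↑ X<B
    open Digits-of-K X C<X (proj₂ gap) (proj₁ gap)

    criterion : evalP ν δ a z ≡ + 0 ⇔ τ p ∣ KVal ν δ B X a z ∣ ((X ∸ 1) * B ^ N) ≡ 0
    criterion = begin
        evalP ν δ a z ≡ + 0                            ≈⟨ P≡0⇔X∣middle-digit ⟩
        ∣ KVal ν δ B X a z ∣ / B ^ N % X ≡ 0           ≈⟨ τ-block ∣ KVal ν δ B X a z ∣ 1<p X∈p↑ (power-^ N B∈p↑) ⟨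
        τ p ∣ KVal ν δ B X a z ∣ ((X ∸ 1) * B ^ N) ≡ 0 ∎
      where open import Relation.Binary.Reasoning.Setoid (⇔-setoid 0ℓ)
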